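{- Let $d\geq 2$, $k\geq 1$, $r\geq -1$ be integers and let $G$ be a complete proper $(r,k,d)$-graph. Then every subgraph $G_0$ of $G$ is proper and has a unique maximal extension.
   Context: An $(r,k,d)$-graph is a graph $G$ with vertex set $\{1,\dots,k\}$ together with, for each edge $\overline{ab}$, values $\xi_G(a,b),\xi_G(b,a)\in\{ -1,\dots,r\}$ and $\eta_G(a,b),\eta_G(b,a)\in\{0,\dots,d-1\}$ such that $\xi_G(a,b)=\xi_G(b,a)$, $\eta_G(a,b)+\eta_G(b,a)\equiv 0\pmod d$, $\eta=0$ when $\xi=-1$, and $\eta\in\{1,\dots,d-1\}$ when $\xi\geq 0$. Complete: every pair of distinct vertices is joined. Proper: for all distinct vertices $a,b,c$ with $\overline{ab},\overline{ac},\overline{bc}$ edges: (1) if $\xi_G(a,b)=\xi_G(b,c)=-1$ then $\xi_G(a,c)=-1$; (2) if $\xi_G(a,b)<\xi_G(b,c)$ then $\xi_G(a,c)=\xi_G(b,c)$ and $\eta_G(a,c)=\eta_G(b,c)$; (3) if $0\leq\xi_G(a,b)=\xi_G(b,c)$ and $\eta_G(a,b)+\eta_G(b,c)\neq d$ then $\xi_G(a,c)=\xi_G(a,b)$ and $\eta_G(a,c)\equiv\eta_G(a,b)+\eta_G(b,c)\pmod d$; (4) if $0\leq\xi_G(a,b)=\xi_G(b,c)$ and $\eta_G(a,b)+\eta_G(b,c)=d$ then $\xi_G(a,c)<\xi_G(a,b)$. $G_0$ is a subgraph of $G$ if every edge of $G_0$ is an edge of $G$ and $\xi_{G_0},\eta_{G_0}$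 agree with $\xi_G,\eta_G$ on it. One-step generation: if $G_0$ is a proper $(r,k,d)$-graph with distinct vertices $a,b,c$ such that $\overline{ab},\overline{bc}$ are edges but $\overline{ac}$ is not, and either (i) $\xi_{G_0}(a,b)=\xi_{G_0}(b,c)=-1$, or (ii) $0\leq\xi_{G_0}(a,b)=\xi_{G_0}(b,c)$ and $\eta_{G_0}(a,b)+\eta_{G_0}(b,c)\neq d$, or (iii) $-1\leq\xi_{G_0}(a,b)<\xi_{G_0}(b,c)$, let $G$ be obtained by adding the edge $\overline{ac}$ with, respectively, (i') $\xi_G(a,c)=-1,\eta_G(a,c)=0$; (ii') $\xi_G(a,c)=\xi_{G_0}(a,b)$ and $\eta_G(a,c)\in\{1,\dots,d-1\}$ congruent to $\eta_{G_0}(a,b)+\eta_{G_0}(b,c)$ mod $d$; (iii') $\xi_G(a,c)=\xi_{G_0}(b,c)$, $\eta_G(a,c)=\eta_{G_0}(b,c)$ (and the values on $(c,a)$ determined by the symmetry rules). If this $G$ is proper, $G_0$ generates $G$. In general $G_0$ generates $G$ if there is a chain $G_0,G_1,\dots,G_s=G$ of proper graphs each obtained from the previous by one-step generation. A maximal extension of $G_0$ is a proper graph $G$ generated by $G_0$ from which no further proper graph can be generated by a one-step generation. -}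

module Defs where

open import Data.Nat as ℕ using (ℕ)
open import Data.Integer as ℤ using (ℤ; +_; -[1+_]; _-_)
open import Data.Integer.Divisibility using (_∣_)
open import Data.Fin using (Fin)
open import Data.Maybe using (Maybe; just; nothing)
open import Data.Product using (Σ; ∃; _×_; _,_)
open import Relation.Binary.PropositionalEquality using (_≡_; _≢_)
open import Relation.Nullary using (¬_)
open import Data.Sum using () renaming (_⊎_ to _⊎'_)

Lab : Set
Lab = ℤ × ℕ

-- A labelled graph on vertex set Fin k: G a b = just (ξ(a,b) , η(a,b))
-- if ab is an edge, nothing otherwise.
RawGraph : ℕ → Set
RawGraph k = Fin k → Fin k → Maybe Lab

_≡_[mod_] : ℕ → ℕ → ℕ → Set
x ≡ y [mod d ] = (+ d) ∣ ((+ x) - (+ y))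

-1ℤ : ℤ
-1ℤ = -[1+ 0 ]

0ℤ : ℤ
0ℤ = + 0

record IsGraph {k : ℕ} (r : ℤ) (d : ℕ) (G : RawGraph k) : Set where
  field
    irrefl  : ∀ a → G a a ≡ nothing
    symNone : ∀ a b → G a b ≡ nothing → G b a ≡ nothing
    symJust : ∀ a b x y → G a b ≡ just (x , y) →
              Σ ℕ λ y' → G b a ≡ just (x , y') × ((y ℕ.+ y') ≡ 0 [mod d ])
    range   : ∀ a b x y → G a b ≡ just (x , y) →
              (-1ℤ ℤ.≤ x) × (x ℤ.≤ r) × (y ℕ.< d)
              × (x ≡ -1ℤ → y ≡ 0) × (0ℤ ℤ.≤ x → 1 ℕ.≤ y)

Complete : {k : ℕ} → RawGraph k → Set
Complete {k} G = ∀ (a b : Fin k) → a ≢ b → Σ Lab λ l → G a b ≡ just l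

Proper : {k : ℕ} → ℕ → RawGraph k → Set
Proper {k} d G =
  ∀ (a b c : Fin k) → a ≢ b → b ≢ c → a ≢ c →
  ∀ x₁ y₁ x₂ y₂ x₃ y₃ →
  G a b ≡ just (x₁ , y₁) → G b c ≡ just (x₂ , y₂) → G a c ≡ just (x₃ , y₃) →
    (x₁ ≡ -1ℤ → x₂ ≡ -1ℤ → x₃ ≡ -1ℤ)
  × (x₁ ℤ.< x₂ → x₃ ≡ x₂ × y₃ ≡ y₂)
  × (0ℤ ℤ.≤ x₁ → x₁ ≡ x₂ → y₁ ℕ.+ y₂ ≢ d → x₃ ≡ x₁ × (y₃ ≡ y₁ ℕ.+ y₂ [mod d ]))
  × (0ℤ ℤ.≤ x₁ → x₁ ≡ x₂ → y₁ ℕ.+ y₂ ≡ d → x₃ ℤ.< x₁)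

IsProper : {k : ℕ} → ℤ → ℕ → RawGraph k → Set
IsProper r d G = IsGraph r d G × Proper d G

Subgraph : {k : ℕ} → RawGraph k → RawGraph k → Set
Subgraph {k} G₀ G = ∀ (a b : Fin k) (l : Lab) → G₀ a b ≡ just l → G a b ≡ just l

_≈G_ : {k : ℕ} → RawGraph k → RawGraph k → Set
_≈G_ {k} G H = ∀ (a b : Fin k) → G a b ≡ H a b

-- label prescribed for the new edge ac by the rules (i')/(ii')/(iii'),
-- given the labels (x₁,y₁) of ab and (x₂,y₂) of bc
NewLabel : ℕ → ℤ → ℕ → ℤ → ℕ → ℤ → ℕ → Set
NewLabel d x₁ y₁ x₂ y₂ x y =
    (x₁ ≡ -1ℤ × x₂ ≡ -1ℤ × x ≡ -1ℤ × y ≡ 0)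
  ⊎' ((0ℤ ℤ.≤ x₁ × x₁ ≡ x₂ × y₁ ℕ.+ y₂ ≢ d)
        × x ≡ x₁ × 1 ℕ.≤ y × y ℕ.< d × (y ≡ y₁ ℕ.+ y₂ [mod d ]))
  ⊎' (x₁ ℤ.< x₂ × x ≡ x₂ × y ≡ y₂)

record OneStep {k : ℕ} (r : ℤ) (d : ℕ) (G₀ G : RawGraph k) : Set where
  field
    proper₀ : IsProper r d G₀
    proper  : IsProper r d G
    a b c   : Fin k
    a≢b     : a ≢ b
    b≢c     : b ≢ c
    a≢c     : a ≢ c
    x₁ x₂ x : ℤ
    y₁ y₂ y : ℕ
    ab      : G₀ a b ≡ just (x₁ , y₁)
    bc      : G₀ b c ≡ just (x₂ , y₂)
    noAC    : G₀ a c ≡ nothing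
    rule    : NewLabel d x₁ y₁ x₂ y₂ x y
    newAC   : G a c ≡ just (x , y)
    newCA   : Σ ℕ λ y' → G c a ≡ just (x , y')
    same    : ∀ u v → ¬ (u ≡ a × v ≡ c) → ¬ (u ≡ c × v ≡ a) → G u v ≡ G₀ u v

data Generates {k : ℕ} (r : ℤ) (d : ℕ) : RawGraph k → RawGraph k → Set where
  done : ∀ {G H} → IsProper r d G → G ≈G H → Generates r d G H
  step : ∀ {G G₁ H} → OneStep r d G G₁ → Generates r d G₁ H → Generates r d G H

MaximalExtension : {k : ℕ} → ℤ → ℕ → RawGraph k → RawGraph k → Set
MaximalExtension {k} r d G₀ H =
  Generates r d G₀ H × ¬ (Σ (RawGraph k) λ H' → OneStep r d H H')

{-# OPTIONS --safe #-}
-- Properness is a condition on triangles of edges, so it passes to every subgraph of G. If a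
-- one-step generation applies at a, b, c in a subgraph K of G, then the complete graph G already
-- has an edge ac, and properness of G says that its label obeys the rule (i')-(iii') of that step.
-- As these rules determine the new label uniquely (η is reduced to {0, …, d-1}), every graph
-- generated from a subgraph of G is again a subgraph of G, and copying the edge ac from G is
-- always a legal step. Generation therefore stops, since the number of non-edges drops, in a graph
-- to which no step applies. Such a saturated graph H' contains every graph generated from G₀: each
-- edge added along a chain must already be in H', or H' would admit a step, and its label in H' is
-- the one from G. Two maximal extensions thus contain each other.
module Submission where

open import Defs
open import Data.Nat as ℕ using (ℕ; zero; suc; _≤_)
import Data.Nat.Properties as ℕP
import Data.Nat.Divisibility as ℕD
open import Data.Nat.Induction using (<-wellFounded)
open import Data.Integer as ℤ using (ℤ; +_; _-_; _⊖_)
import Data.Integer.Properties as ℤP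
open import Data.Integer.Divisibility using (_∣_)
import Data.Integer.Divisibility.Signed as Signed
open import Data.Integer.Solver using (module +-*-Solver)
open import Algebra.Properties.Monoid.Sum ℕP.+-0-monoid using (sum)
open import Data.Fin using (Fin) renaming (zero to fzero; suc to fsuc)
open import Data.Fin.Properties using (_≟_; any?)
open import Data.Maybe using (Maybe; just; nothing)
open import Data.Maybe.Properties using (just-injective)
open import Data.Product using (Σ; _×_; _,_; proj₁; proj₂)
open import Data.Sum using (_⊎_; inj₁; inj₂; [_,_])
open import Data.Empty using (⊥-elim)
open import Function using (_∘_)
open import Induction.WellFounded using (Acc; acc)
open import Relation.Binary.PropositionalEquality
  using (_≡_; _≢_; refl; sym; trans; cong; subst; subst₂; module ≡-Reasoning)
open import Relation.Nullary using (¬_; Dec; yes; no; contradiction)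
open import Relation.Nullary.Decidable using (_×-dec_; _⊎-dec_; ¬?; map′)

private variable
  k d : ℕ
  r : ℤ
  a b c u v : Fin k
  x x₁ x₂ x' : ℤ
  y y₁ y₂ y' : ℕ
  l : Lab
  m m' : Maybe Lab
  G H H' K K₁ : RawGraph k

≡-mod-unique : ∀ {d x y} → x ℕ.< d → y ℕ.< d → x ≡ y [mod d ] → x ≡ y
≡-mod-unique {d} {x} {y} x<d y<d d∣x-y with ℤ.∣ + x - + y ∣ in ∣x-y∣≡
... | zero = ℤP.+-injective (ℤP.i-j≡0⇒i≡j _ _ (ℤP.∣i∣≡0⇒i≡0 ∣x-y∣≡))
... | suc n = contradiction d∣x-y (ℕD.>⇒∤ (ℕP.≤-<-trans ∣x-y∣≤x⊔y (ℕP.⊔-lub x<d y<d)))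
  where
  ∣x-y∣≤x⊔y : suc n ≤ x ℕ.⊔ y
  ∣x-y∣≤x⊔y = subst (_≤ x ℕ.⊔ y) (trans (cong ℤ.∣_∣ (sym (ℤP.m-n≡m⊖n x y))) ∣x-y∣≡)
                    (ℤP.∣m⊝n∣≤m⊔n x y)

≡-mod-via : ∀ {d a b c} → a ≡ c [mod d ] → b ≡ c [mod d ] → a ≡ b [mod d ]
≡-mod-via {d} {a} {b} {c} a≡c b≡c =
  Signed.∣⇒∣ᵤ (subst (Signed._∣_ (+ d)) (sym split)
    (Signed.∣m∣n⇒∣m-n (Signed.∣ᵤ⇒∣ {i = + a - + c} a≡c) (Signed.∣ᵤ⇒∣ {i = + b - + c} b≡c)))
  where
  open +-*-Solver
  split : + a - + b ≡ (+ a - + c) - (+ b - + c)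
  split = solve 3 (λ a b c → a :- b := (a :- c) :- (b :- c)) refl (+ a) (+ b) (+ c)

+-cancelˡ-≡-mod : ∀ {d} (y : ℕ) {y₁ y₂ : ℕ} →
                  (y ℕ.+ y₁) ≡ (y ℕ.+ y₂) [mod d ] → y₁ ≡ y₂ [mod d ]
+-cancelˡ-≡-mod {d} y {y₁} {y₂} = subst (+ d ∣_) difference
  where
  open ≡-Reasoning
  difference : + (y ℕ.+ y₁) - + (y ℕ.+ y₂) ≡ + y₁ - + y₂
  difference = begin
    + (y ℕ.+ y₁) - + (y ℕ.+ y₂) ≡⟨ ℤP.m-n≡m⊖n (y ℕ.+ y₁) (y ℕ.+ y₂) ⟩
    (y ℕ.+ y₁) ⊖ (y ℕ.+ y₂)     ≡⟨ ℤP.+-cancelˡ-⊖ y y₁ y₂ ⟩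
    y₁ ⊖ y₂                     ≡⟨ ℤP.m-n≡m⊖n y₁ y₂ ⟨
    + y₁ - + y₂                 ∎

StepCondition : ℕ → Lab → Lab → Set
StepCondition d (x₁ , y₁) (x₂ , y₂) =
  (x₁ ≡ -1ℤ × x₂ ≡ -1ℤ) ⊎ (0ℤ ℤ.≤ x₁ × x₁ ≡ x₂ × y₁ ℕ.+ y₂ ≢ d) ⊎ x₁ ℤ.< x₂

stepCondition? : ∀ d l₁ l₂ → Dec (StepCondition d l₁ l₂)
stepCondition? d (x₁ , y₁) (x₂ , y₂) =
  (x₁ ℤP.≟ -1ℤ ×-dec x₂ ℤP.≟ -1ℤ)
  ⊎-dec (0ℤ ℤP.≤? x₁ ×-dec x₁ ℤP.≟ x₂ ×-dec ¬? (y₁ ℕ.+ y₂ ℕP.≟ d))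
  ⊎-dec x₁ ℤP.<? x₂

NewLabel⇒StepCondition : NewLabel d x₁ y₁ x₂ y₂ x y → StepCondition d (x₁ , y₁) (x₂ , y₂)
NewLabel⇒StepCondition (inj₁ (x₁≡-1 , x₂≡-1 , _))  = inj₁ (x₁≡-1 , x₂≡-1)
NewLabel⇒StepCondition (inj₂ (inj₁ (cond , _)))     = inj₂ (inj₁ cond)
NewLabel⇒StepCondition (inj₂ (inj₂ (x₁<x₂ , _)))   = inj₂ (inj₂ x₁<x₂)

NewLabel-unique : NewLabel d x₁ y₁ x₂ y₂ x y → NewLabel d x₁ y₁ x₂ y₂ x' y' →
                  (x , y) ≡ (x' , y')
NewLabel-unique (inj₁ (_ , _ , refl , refl)) (inj₁ (_ , _ , refl , refl)) = refl
NewLabel-unique (inj₁ (refl , _)) (inj₂ (inj₁ ((() , _) , _)))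
NewLabel-unique (inj₁ (refl , refl , _)) (inj₂ (inj₂ (-1<-1 , _))) = ⊥-elim (ℤP.<-irrefl refl -1<-1)
NewLabel-unique (inj₂ (inj₁ ((() , _) , _))) (inj₁ (refl , _))
NewLabel-unique {y₁ = y₁} {y₂ = y₂}
  (inj₂ (inj₁ (_ , refl , _ , y<d , y≡sum))) (inj₂ (inj₁ (_ , refl , _ , y'<d , y'≡sum))) =
  cong (_ ,_) (≡-mod-unique y<d y'<d (≡-mod-via {c = y₁ ℕ.+ y₂} y≡sum y'≡sum))
NewLabel-unique (inj₂ (inj₁ ((_ , x₁≡x₂ , _) , _))) (inj₂ (inj₂ (x₁<x₂ , _))) =
  ⊥-elim (ℤP.<-irrefl x₁≡x₂ x₁<x₂)
NewLabel-unique (inj₂ (inj₂ (-1<-1 , _))) (inj₁ (refl , refl , _)) = ⊥-elim (ℤP.<-irrefl refl -1<-1)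
NewLabel-unique (inj₂ (inj₂ (x₁<x₂ , _))) (inj₂ (inj₁ ((_ , x₁≡x₂ , _) , _))) =
  ⊥-elim (ℤP.<-irrefl x₁≡x₂ x₁<x₂)
NewLabel-unique (inj₂ (inj₂ (_ , refl , refl))) (inj₂ (inj₂ (_ , refl , refl))) = refl

≈G-sym : G ≈G H → H ≈G G
≈G-sym G≈H u v = sym (G≈H u v)

≈G⇒Subgraph : G ≈G H → Subgraph G H
≈G⇒Subgraph G≈H u v l Guv = trans (sym (G≈H u v)) Guv

Subgraph-trans : Subgraph G H → Subgraph H K → Subgraph G K
Subgraph-trans G⊆H H⊆K u v l = H⊆K u v l ∘ G⊆H u v l

Subgraph-antisym : Subgraph G H → Subgraph H G → G ≈G H
Subgraph-antisym {G = G} {H = H} G⊆H H⊆G u v with G u v in Guv | H u v in Huv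
... | just l  | _      = trans (sym (G⊆H u v l Guv)) Huv
... | nothing | just l = contradiction (trans (sym (H⊆G u v l Huv)) Guv) λ ()
... | nothing | nothing = refl

Subgraph⇒edge : Subgraph H H' → H u v ≡ just l → H' u v ≢ nothing
Subgraph⇒edge H⊆H' Huv H'uv = contradiction (trans (sym (H⊆H' _ _ _ Huv)) H'uv) λ ()

Subgraph-fromEdges : Subgraph H G → Subgraph H' G →
                     (∀ u v l → H u v ≡ just l → H' u v ≢ nothing) → Subgraph H H'
Subgraph-fromEdges {H' = H'} H⊆G H'⊆G hasEdge u v l Huv with H' u v in H'uv
... | just l' = cong just (just-injective (trans (sym (H'⊆G u v l' H'uv)) (H⊆G u v l Huv)))
... | nothing = contradiction H'uv (hasEdge u v l Huv)

Proper-subgraph : Proper d G → Subgraph H G → Proper d H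
Proper-subgraph properG H⊆G a b c a≢b b≢c a≢c x₁ y₁ x₂ y₂ x₃ y₃ ab bc ac =
  properG a b c a≢b b≢c a≢c x₁ y₁ x₂ y₂ x₃ y₃ (H⊆G _ _ _ ab) (H⊆G _ _ _ bc) (H⊆G _ _ _ ac)

NonEdgesSymmetric : RawGraph k → Set
NonEdgesSymmetric {k} H = ∀ (a b : Fin k) → H a b ≡ nothing → H b a ≡ nothing

IsGraph-subgraph : IsGraph r d G → Subgraph H G → NonEdgesSymmetric H → IsGraph r d H
IsGraph-subgraph {d = d} {H = H} isG H⊆G symH = record
  { irrefl  = irrefl
  ; symNone = symH
  ; symJust = symJust
  ; range   = λ a b x y → G.range a b x y ∘ H⊆G a b _
  }
  where
  module G = IsGraph isG

  irrefl : ∀ a → H a a ≡ nothing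
  irrefl a with H a a in Haa
  ... | nothing = refl
  ... | just l  = contradiction (trans (sym (H⊆G a a l Haa)) (G.irrefl a)) λ ()

  symJust : ∀ a b x y → H a b ≡ just (x , y) →
            Σ ℕ λ y' → H b a ≡ just (x , y') × ((y ℕ.+ y') ≡ 0 [mod d ])
  symJust a b x y Hab with G.symJust a b x y (H⊆G a b _ Hab) | H b a in Hba
  ... | y' , Gba , y+y'≡0 | just l  = y' , trans (sym (H⊆G b a l Hba)) Gba , y+y'≡0
  ... | _ | nothing = contradiction (trans (sym Hab) (symH b a Hba)) λ ()

IsProper-subgraph : IsProper r d G → Subgraph H G → NonEdgesSymmetric H → IsProper r d H
IsProper-subgraph (isG , properG) H⊆G symH =
  IsGraph-subgraph isG H⊆G symH , Proper-subgraph properG H⊆G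

IsProper-resp-≈G : G ≈G H → IsProper r d G → IsProper r d H
IsProper-resp-≈G G≈H properG@(isG , _) =
  IsProper-subgraph properG (≈G⇒Subgraph (≈G-sym G≈H)) symH
  where
  symH : NonEdgesSymmetric _
  symH a b Hab = trans (sym (G≈H b a)) (IsGraph.symNone isG a b (trans (G≈H a b) Hab))

label<d : IsGraph r d G → G a b ≡ just (x , y) → y ℕ.< d
label<d isG Gab = proj₁ (proj₂ (proj₂ (IsGraph.range isG _ _ _ _ Gab)))

reverseLabel-unique : IsGraph r d G → IsGraph r d H →
                      G a b ≡ just l → H a b ≡ just l → G b a ≡ H b a
reverseLabel-unique {a = a} {b = b} {l = x , y} isG isH Gab Hab
  with IsGraph.symJust isG a b x y Gab | IsGraph.symJust isH a b x y Hab
... | y₁ , Gba , y+y₁≡0 | y₂ , Hba , y+y₂≡0 =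
  trans Gba (trans (cong (λ η → just (x , η)) y₁≡y₂) (sym Hba))
  where
  y₁≡y₂ : y₁ ≡ y₂
  y₁≡y₂ = ≡-mod-unique (label<d isG Gba) (label<d isH Hba)
                       (+-cancelˡ-≡-mod y (≡-mod-via {c = 0} y+y₁≡0 y+y₂≡0))

proper⇒NewLabel : IsProper r d G → a ≢ b → b ≢ c → a ≢ c →
                  G a b ≡ just (x₁ , y₁) → G b c ≡ just (x₂ , y₂) → G a c ≡ just (x , y) →
                  StepCondition d (x₁ , y₁) (x₂ , y₂) → NewLabel d x₁ y₁ x₂ y₂ x y
proper⇒NewLabel (isG , properG) a≢b b≢c a≢c ab bc ac cond
  with properG _ _ _ a≢b b≢c a≢c _ _ _ _ _ _ ab bc ac | IsGraph.range isG _ _ _ _ ac | cond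
... | rule₁ , _ | _ , _ , _ , η≡0 , _ | inj₁ (x₁≡-1 , x₂≡-1) =
  inj₁ (x₁≡-1 , x₂≡-1 , rule₁ x₁≡-1 x₂≡-1 , η≡0 (rule₁ x₁≡-1 x₂≡-1))
... | _ , _ , rule₃ , _ | _ , _ , y<d , _ , η≥1 | inj₂ (inj₁ cond₂@(0≤x₁ , x₁≡x₂ , sum≢d)) =
  let x≡x₁ , y≡sum = rule₃ 0≤x₁ x₁≡x₂ sum≢d in
  inj₂ (inj₁ (cond₂ , x≡x₁ , η≥1 (subst (0ℤ ℤ.≤_) (sym x≡x₁) 0≤x₁) , y<d , y≡sum))
... | _ , rule₂ , _ | _ | inj₂ (inj₂ x₁<x₂) = inj₂ (inj₂ (x₁<x₂ , rule₂ x₁<x₂))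

SameEdge : Fin k → Fin k → Fin k → Fin k → Set
SameEdge a c u v = (u ≡ a × v ≡ c) ⊎ (u ≡ c × v ≡ a)

sameEdge? : (a c u v : Fin k) → Dec (SameEdge a c u v)
sameEdge? a c u v = (u ≟ a ×-dec v ≟ c) ⊎-dec (u ≟ c ×-dec v ≟ a)

SameEdge-flip : SameEdge a c u v → SameEdge a c v u
SameEdge-flip (inj₁ (u≡a , v≡c)) = inj₂ (v≡c , u≡a)
SameEdge-flip (inj₂ (u≡c , v≡a)) = inj₁ (v≡a , u≡c)

module _ (s : OneStep r d K K₁) where
  private module S = OneStep s

  OneStep-view : ∀ u v → SameEdge S.a S.c u v ⊎ K₁ u v ≡ K u v
  OneStep-view u v with sameEdge? S.a S.c u v
  ... | yes ac = inj₁ ac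
  ... | no ¬ac = inj₂ (S.same u v (¬ac ∘ inj₁) (¬ac ∘ inj₂))

  OneStep⇒Subgraph : Subgraph K K₁
  OneStep⇒Subgraph u v l Kuv with OneStep-view u v
  ... | inj₁ (inj₁ (refl , refl)) = contradiction (trans (sym Kuv) S.noAC) λ ()
  ... | inj₁ (inj₂ (refl , refl)) =
        contradiction (trans (sym Kuv) (IsGraph.symNone (proj₁ S.proper₀) S.a S.c S.noAC)) λ ()
  ... | inj₂ K₁uv≡Kuv = trans K₁uv≡Kuv Kuv

Generates⇒Subgraph : Generates r d K H → Subgraph K H
Generates⇒Subgraph (done _ K≈H) = ≈G⇒Subgraph K≈H
Generates⇒Subgraph (step s gen) = Subgraph-trans (OneStep⇒Subgraph s) (Generates⇒Subgraph gen)

Generates⇒IsProper : Generates r d K H → IsProper r d H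
Generates⇒IsProper (done properK K≈H) = IsProper-resp-≈G K≈H properK
Generates⇒IsProper (step _ gen)       = Generates⇒IsProper gen

sum-mono-≤ : ∀ {n} {f g : Fin n → ℕ} → (∀ i → f i ≤ g i) → sum f ≤ sum g
sum-mono-≤ {zero}  f≤g = ℕ.z≤n
sum-mono-≤ {suc n} f≤g = ℕP.+-mono-≤ (f≤g fzero) (sum-mono-≤ (f≤g ∘ fsuc))

sum-mono-< : ∀ {n} {f g : Fin n → ℕ} → (∀ i → f i ≤ g i) → ∀ j → f j ℕ.< g j → sum f ℕ.< sum g
sum-mono-< f≤g fzero    fj<gj = ℕP.+-mono-<-≤ fj<gj (sum-mono-≤ (f≤g ∘ fsuc))
sum-mono-< f≤g (fsuc j) fj<gj = ℕP.+-mono-≤-< (f≤g fzero) (sum-mono-< (f≤g ∘ fsuc) j fj<gj)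

isNonEdge : Maybe Lab → ℕ
isNonEdge nothing  = 1
isNonEdge (just _) = 0

isNonEdge-antitone : (∀ l → m ≡ just l → m' ≡ just l) → isNonEdge m' ≤ isNonEdge m
isNonEdge-antitone {m = nothing} {m' = nothing} _ = ℕP.≤-refl
isNonEdge-antitone {m = nothing} {m' = just _} _ = ℕ.z≤n
isNonEdge-antitone {m = just l} m⇒m' rewrite m⇒m' l refl = ℕ.z≤n

nonEdges : RawGraph k → ℕ
nonEdges H = sum λ u → sum λ v → isNonEdge (H u v)

nonEdges-< : Subgraph K K₁ → K a c ≡ nothing → K₁ a c ≡ just l → nonEdges K₁ ℕ.< nonEdges K
nonEdges-< {K = K} {K₁ = K₁} {a = a} {c = c} K⊆K₁ Kac K₁ac =
  sum-mono-< (λ u → sum-mono-≤ (antitone u)) a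
    (sum-mono-< (antitone a) c
      (subst₂ (λ m m' → isNonEdge m ℕ.< isNonEdge m') (sym K₁ac) (sym Kac) ℕP.≤-refl))
  where
  antitone : ∀ u v → isNonEdge (K₁ u v) ≤ isNonEdge (K u v)
  antitone u v = isNonEdge-antitone (K⊆K₁ u v)

OneStep-nonEdges-< : OneStep r d K K₁ → nonEdges K₁ ℕ.< nonEdges K
OneStep-nonEdges-< s = nonEdges-< (OneStep⇒Subgraph s) noAC newAC
  where open OneStep s

Chainable : ℕ → Maybe Lab → Maybe Lab → Set
Chainable d m₁ m₂ =
  Σ Lab λ l₁ → Σ Lab λ l₂ → m₁ ≡ just l₁ × m₂ ≡ just l₂ × StepCondition d l₁ l₂

chainable? : ∀ d m₁ m₂ → Dec (Chainable d m₁ m₂)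
chainable? d (just l₁) (just l₂) =
  map′ (λ cond → l₁ , l₂ , refl , refl , cond) (λ { (_ , _ , refl , refl , cond) → cond })
       (stepCondition? d l₁ l₂)
chainable? d nothing   _         = no λ { (_ , _ , () , _) }
chainable? d (just _)  nothing   = no λ { (_ , _ , _ , () , _) }

Applicable : ℕ → RawGraph k → Fin k → Fin k → Fin k → Set
Applicable d H a b c = a ≢ b × b ≢ c × a ≢ c × H a c ≡ nothing × Chainable d (H a b) (H b c)

isNothing? : (m : Maybe Lab) → Dec (m ≡ nothing)
isNothing? nothing  = yes refl
isNothing? (just _) = no λ ()

applicable? : ∀ d (H : RawGraph k) a b c → Dec (Applicable d H a b c)
applicable? d H a b c =
  ¬? (a ≟ b) ×-dec ¬? (b ≟ c) ×-dec ¬? (a ≟ c)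
  ×-dec isNothing? (H a c) ×-dec chainable? d (H a b) (H b c)

OneStep⇒Applicable : (s : OneStep r d K K₁) →
                     Applicable d K (OneStep.a s) (OneStep.b s) (OneStep.c s)
OneStep⇒Applicable s = a≢b , b≢c , a≢c , noAC , _ , _ , ab , bc , NewLabel⇒StepCondition rule
  where open OneStep s

Applicable-mono : Subgraph K H → H a c ≡ nothing → Applicable d K a b c → Applicable d H a b c
Applicable-mono K⊆H Hac (a≢b , b≢c , a≢c , _ , l₁ , l₂ , ab , bc , cond) =
  a≢b , b≢c , a≢c , Hac , l₁ , l₂ , K⊆H _ _ _ ab , K⊆H _ _ _ bc , cond

Saturated : ℤ → ℕ → RawGraph k → Set
Saturated {k} r d H = ¬ (Σ (RawGraph k) λ H' → OneStep r d H H')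

insertEdge : RawGraph k → Fin k → Fin k → RawGraph k → RawGraph k
insertEdge G a c H u v with sameEdge? a c u v
... | yes _ = G u v
... | no _  = H u v

insertEdge-on : SameEdge a c u v → insertEdge G a c H u v ≡ G u v
insertEdge-on {a = a} {c = c} {u = u} {v = v} ac with sameEdge? a c u v
... | yes _  = refl
... | no ¬ac = contradiction ac ¬ac

insertEdge-off : ¬ SameEdge a c u v → insertEdge G a c H u v ≡ H u v
insertEdge-off {a = a} {c = c} {u = u} {v = v} ¬ac with sameEdge? a c u v
... | yes ac = contradiction ac ¬ac
... | no _   = refl

insertEdge-⊆ : Subgraph H G → Subgraph (insertEdge G a c H) G
insertEdge-⊆ {a = a} {c = c} H⊆G u v l e with sameEdge? a c u v
... | yes _ = e
... | no _  = H⊆G u v l e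

insertEdge-nonEdgesSymmetric : IsGraph r d G → IsGraph r d H →
                               NonEdgesSymmetric (insertEdge G a c H)
insertEdge-nonEdgesSymmetric {a = a} {c = c} isG isH u v e with sameEdge? a c u v
... | yes ac = trans (insertEdge-on (SameEdge-flip ac)) (IsGraph.symNone isG u v e)
... | no ¬ac = trans (insertEdge-off (¬ac ∘ SameEdge-flip)) (IsGraph.symNone isH u v e)

module WithinComplete {G : RawGraph k} (properG : IsProper r d G) (complete : Complete G) where
  private
    isG = proj₁ properG

  newEdge-agrees : (s : OneStep r d K K₁) → Subgraph K G →
                   G (OneStep.a s) (OneStep.c s) ≡ K₁ (OneStep.a s) (OneStep.c s)
  newEdge-agrees s K⊆G =
    trans Gac (trans (cong just (NewLabel-unique G-rule S.rule)) (sym S.newAC))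
    where
    module S = OneStep s
    Gac = proj₂ (complete S.a S.c S.a≢c)
    G-rule = proper⇒NewLabel properG S.a≢b S.b≢c S.a≢c (K⊆G _ _ _ S.ab) (K⊆G _ _ _ S.bc) Gac
                             (NewLabel⇒StepCondition S.rule)

  OneStep-within : OneStep r d K K₁ → Subgraph K G → Subgraph K₁ G
  OneStep-within s K⊆G u v l K₁uv with OneStep-view s u v
  ... | inj₁ (inj₁ (refl , refl)) = trans (newEdge-agrees s K⊆G) K₁uv
  ... | inj₁ (inj₂ (refl , refl)) =
        trans (reverseLabel-unique isG (proj₁ (OneStep.proper s))
                (trans (newEdge-agrees s K⊆G) (OneStep.newAC s)) (OneStep.newAC s)) K₁uv
  ... | inj₂ K₁uv≡Kuv = K⊆G u v l (trans (sym K₁uv≡Kuv) K₁uv)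

  Generates-within : Generates r d K H → Subgraph K G → Subgraph H G
  Generates-within (done _ K≈H) K⊆G = Subgraph-trans (≈G⇒Subgraph (≈G-sym K≈H)) K⊆G
  Generates-within (step s gen) K⊆G = Generates-within gen (OneStep-within s K⊆G)

  Applicable⇒OneStep : IsProper r d H → Subgraph H G → Applicable d H a b c →
                       Σ (RawGraph k) (OneStep r d H)
  Applicable⇒OneStep {H = H} {a = a} {b = b} {c = c} properH H⊆G
         (a≢b , b≢c , a≢c , noAC , (x₁ , y₁) , (x₂ , y₂) , ab , bc , cond)
    with complete a c a≢c
  ... | (x , y) , Gac = insertEdge G a c H , record
    { proper₀ = properH
    ; proper  = IsProper-subgraph properG (insertEdge-⊆ H⊆G)
                  (insertEdge-nonEdgesSymmetric isG (proj₁ properH))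
    ; a = a ; b = b ; c = c ; a≢b = a≢b ; b≢c = b≢c ; a≢c = a≢c
    ; x₁ = x₁ ; x₂ = x₂ ; x = x ; y₁ = y₁ ; y₂ = y₂ ; y = y
    ; ab = ab ; bc = bc ; noAC = noAC
    ; rule  = proper⇒NewLabel properG a≢b b≢c a≢c (H⊆G _ _ _ ab) (H⊆G _ _ _ bc) Gac cond
    ; newAC = trans (insertEdge-on {G = G} {H = H} (inj₁ (refl , refl))) Gac
    ; newCA = let y' , Gca , _ = IsGraph.symJust isG a c x y Gac in
              y' , trans (insertEdge-on {G = G} {H = H} (inj₂ (refl , refl))) Gca
    ; same  = λ u v ¬ac ¬ca → insertEdge-off {G = G} {H = H} [ ¬ac , ¬ca ]
    }

  maximalExtension-exists : IsProper r d K → Subgraph K G →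
                            Σ (RawGraph k) (MaximalExtension r d K)
  maximalExtension-exists {K = K} properK K⊆G = go properK K⊆G (<-wellFounded (nonEdges K))
    where
    go : ∀ {K} → IsProper r d K → Subgraph K G → Acc ℕ._<_ (nonEdges K) →
         Σ (RawGraph k) (MaximalExtension r d K)
    go {K} properK K⊆G (acc rec)
      with any? (λ a → any? (λ b → any? (λ c → applicable? d K a b c)))
    ... | yes (_ , _ , _ , app) =
          let K₁ , s = Applicable⇒OneStep properK K⊆G app
              H , gen , sat = go (OneStep.proper s) (OneStep-within s K⊆G)
                                 (rec (OneStep-nonEdges-< s))
          in H , step s gen , sat
    ... | no none =
          K , done properK (λ _ _ → refl) , λ (_ , s) → none (_ , _ , _ , OneStep⇒Applicable s)

  generated⊆saturated : Generates r d K H → Subgraph K G →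
                        IsProper r d H' → Subgraph H' G → Saturated r d H' →
                        Subgraph K H' → Subgraph H H'
  generated⊆saturated (done _ K≈H) _ _ _ _ K⊆H' = Subgraph-trans (≈G⇒Subgraph (≈G-sym K≈H)) K⊆H'
  generated⊆saturated {H' = H'} (step {G₁ = K₁} s gen) K⊆G properH' H'⊆G sat K⊆H' =
    generated⊆saturated gen K₁⊆G properH' H'⊆G sat (Subgraph-fromEdges K₁⊆G H'⊆G hasEdge)
    where
    module S = OneStep s
    K₁⊆G = OneStep-within s K⊆G

    hasAC : H' S.a S.c ≢ nothing
    hasAC noAC =
      sat (Applicable⇒OneStep properH' H'⊆G (Applicable-mono K⊆H' noAC (OneStep⇒Applicable s)))

    hasEdge : ∀ u v l → K₁ u v ≡ just l → H' u v ≢ nothing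
    hasEdge u v l K₁uv with OneStep-view s u v
    ... | inj₁ (inj₁ (refl , refl)) = hasAC
    ... | inj₁ (inj₂ (refl , refl)) = hasAC ∘ IsGraph.symNone (proj₁ properH') S.c S.a
    ... | inj₂ K₁uv≡Kuv = Subgraph⇒edge K⊆H' (trans (sym K₁uv≡Kuv) K₁uv)

  maximalExtension-unique : Subgraph K G →
                            MaximalExtension r d K H → MaximalExtension r d K H' → H' ≈G H
  maximalExtension-unique {K = K} K⊆G (gen , sat) (gen' , sat') =
    Subgraph-antisym (into gen' gen sat) (into gen gen' sat')
    where
    into : ∀ {H₁ H₂} → Generates r d K H₁ → Generates r d K H₂ → Saturated r d H₂ →
           Subgraph H₁ H₂
    into gen₁ gen₂ sat₂ =
      generated⊆saturated gen₁ K⊆G (Generates⇒IsProper gen₂) (Generates-within gen₂ K⊆G) sat₂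
                          (Generates⇒Subgraph gen₂)

lemma2p11 : (d k : ℕ) (r : ℤ) → 2 ≤ d → 1 ≤ k → -1ℤ ℤ.≤ r →
    (G : RawGraph k) → IsProper r d G → Complete G →
    (G₀ : RawGraph k) → IsGraph r d G₀ → Subgraph G₀ G →
    Proper d G₀ ×
    Σ (RawGraph k) (λ H → MaximalExtension r d G₀ H
      × ((H' : RawGraph k) → MaximalExtension r d G₀ H' → H' ≈G H))
lemma2p11 d k r _ _ _ G properG complete G₀ isG₀ G₀⊆G =
  let H , maximal = maximalExtension-exists (isG₀ , proper₀) G₀⊆G in
  proper₀ , H , maximal , λ H' maximal' → maximalExtension-unique G₀⊆G maximal maximal'
  where
  open WithinComplete properG complete
  proper₀ : Proper d G₀
  proper₀ = Proper-subgraph (proj₂ properG) G₀⊆G
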